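{- Let $P$ be a decreasing tableau, $(r,c)$ a removable cell of $P$, $\alpha\in\{0,1\}$, and run $\Psi(P,(r,c),\alpha)=(P',m)$, with bumping path $m_r<\dots<m_1$ and status indicators $\alpha_r,\dots,\alpha_1$ as produced by the algorithm. Then for every $1\le i\le r$, $\alpha_i=0$ if and only if $m_i$ is $P'_{\ge i}$-ejectable, where $P'$ is the output tableau.
   Context: Tableaux use English notation; cell $(i,j)$ is in row $i$, column $j$. A decreasing tableau is a filling of the diagram of a partition by positive integers strictly decreasing from left to right along rows and from top to bottom along columns. A cell is removable if it is the last cell of its row and the bottom cell of its column. $P_{>r}$ denotes the tableau obtained by deleting the first $r$ rows of $P$ (rows renumbered from 1), and $P_{\ge r}=P_{>r-1}$. A value $x$ is $P$-ejectable if $x$ occurs in the first row of $P$ and either $x-1$ does not occur in the first row, or $x-1$ occurs in the first row and $x-1$ is $P_{>1}$-ejectable (nothing is ejectable in the empty tableau). Bumping path of a removable cell $(r,c)$ of $P$: $m_r$ is the entry at $(r,c)$, and for $i=r-1,\dots,1$, $m_i$ is the smallest entry of row $i$ with $m_i>m_{i+1}$. Reverse insertion $\Psi(P,(r,c),\alpha)=(P',m)$: compute the bumping path; set $m:=m_1$, $P':=P$. If $\alpha=1$, delete cell $(r,c)$ from $P'$, set $\alpha_r=1$, and process rows $i=r-1,\dots,1$. If $\alpha=0$, set $m_{r+1}=0$, $\alpha_{r+1}=0$, and process rows $i=r,\dots,1$. Processing row $i$ with $R$ the set of entries of row $i$ of $P$: (D) if $m_i-1\in R$, leave row $i$, $\alpha_i=\alpha_{i+1}$;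 (DR) else if $\alpha_{i+1}=1$ and $m_{i+1}\notin R$, replace $m_i$ in row $i$ of $P'$ by $m_{i+1}$, $\alpha_i=1$; otherwise let $x$ be the smallest $P'_{>i}$-ejectable value (current $P'$) with $m_{i+1}<x<m_i$: (IR) if $x$ exists replace $m_i$ by $x$, $\alpha_i=1$; (NR) else leave row $i$, $\alpha_i=0$. Output final $P'$ and $m$. (Processing row $i$ changes only row $i$, so $P'_{\ge i}$ is not altered by the processing of rows above $i$.) -}

module Defs where

open import Data.Nat using (ℕ; zero; suc; _∸_; _≤_; _<_; _≡ᵇ_; _<ᵇ_; _⊓_)
open import Data.Bool using (Bool; true; false; _∧_; _∨_; not; if_then_else_)
open import Data.List using (List; []; _∷_; length; take; drop; map; upTo)
open import Data.List.Relation.Unary.All using (All)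
open import Data.List.Relation.Unary.Linked using (Linked)
open import Data.Maybe using (Maybe; just; nothing; fromMaybe)
open import Data.Product using (_×_; _,_; proj₁; proj₂)
open import Relation.Binary.PropositionalEquality using (_≡_)
open import Relation.Nullary using (¬_)

-- A tableau is the list of its rows (row 1 first), each row a list of
-- entries (column 1 first).
Tableau : Set
Tableau = List (List ℕ)

elem : ℕ → List ℕ → Bool
elem x []       = false
elem x (y ∷ ys) = (x ≡ᵇ y) ∨ elem x ys

-- Row i of P (1-based); [] if there is no such row.
row : Tableau → ℕ → List ℕ
row P        zero          = []
row []       (suc i)       = []
row (R ∷ P)  (suc zero)    = R
row (R ∷ P)  (suc (suc i)) = row P (suc i)

nth : List ℕ → ℕ → Maybe ℕ
nth xs       zero          = nothing
nth []       (suc j)       = nothing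
nth (x ∷ xs) (suc zero)    = just x
nth (x ∷ xs) (suc (suc j)) = nth xs (suc j)

entry : Tableau → ℕ → ℕ → Maybe ℕ
entry P i j = nth (row P i) j

record IsDecreasingTableau (P : Tableau) : Set where
  field
    rowsNonempty : All (λ R → ¬ (R ≡ [])) P
    positive     : All (All (λ x → 0 < x)) P
    shape        : Linked (λ R S → length S ≤ length R) P
    rowsDecr     : All (Linked (λ x y → y < x)) P
    colsDecr     : ∀ i j x y → entry P i j ≡ just x → entry P (suc i) j ≡ just y → y < x

record Removable (P : Tableau) (r c : ℕ) : Set where
  field
    r≥1      : 1 ≤ r
    c≥1      : 1 ≤ c
    lastInRow : length (row P r) ≡ c
    bottomInCol : length (row P (suc r)) < c

ejectable : ℕ → Tableau → Bool
ejectable x []      = false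
ejectable x (R ∷ P) =
  elem x R ∧ (not (elem (x ∸ 1) R) ∨ (elem (x ∸ 1) R ∧ ejectable (x ∸ 1) P))

-- smallest entry of the row strictly greater than y (0 if none).
minGT : ℕ → List ℕ → ℕ
minGT y []      = 0
minGT y (z ∷ R) with minGT y R
... | acc = if y <ᵇ z then (if acc ≡ᵇ 0 then z else (z ⊓ acc)) else acc

-- Bumping path: pathGo P r c k = m_{r ∸ k}.
pathGo : Tableau → ℕ → ℕ → ℕ → ℕ
pathGo P r c zero    = fromMaybe 0 (entry P r c)
pathGo P r c (suc k) = minGT (pathGo P r c k) (row P (r ∸ suc k))

path : Tableau → ℕ → ℕ → ℕ → ℕ
path P r c i = pathGo P r c (r ∸ i)

updateRow : ℕ → (List ℕ → List ℕ) → Tableau → Tableau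
updateRow zero          f P       = P
updateRow (suc i)       f []      = []
updateRow (suc zero)    f (R ∷ P) = f R ∷ P
updateRow (suc (suc i)) f (R ∷ P) = R ∷ updateRow (suc i) f P

replaceVal : ℕ → ℕ → List ℕ → List ℕ
replaceVal a b = map (λ y → if y ≡ᵇ a then b else y)

findᵇ : (ℕ → Bool) → List ℕ → Maybe ℕ
findᵇ p []       = nothing
findᵇ p (x ∷ xs) = if p x then just x else findᵇ p xs

smallestEjectable : ℕ → ℕ → Tableau → Maybe ℕ
smallestEjectable lo hi T = findᵇ (λ x → (lo <ᵇ x) ∧ ejectable x T) (upTo hi)

-- Processing row i: R = row i of the original P, mi = m_i, mi1 = m_{i+1},
-- ai1 = α_{i+1}, P' the current tableau.  Returns new P' and α_i.
processRow : List ℕ → ℕ → ℕ → ℕ → Bool → Tableau → Tableau × Bool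
processRow R i mi mi1 ai1 P' =
  if elem (mi ∸ 1) R then (P' , ai1)                                    -- (D)
  else if ai1 ∧ not (elem mi1 R) then (updateRow i (replaceVal mi mi1) P' , true)  -- (DR)
  else go (smallestEjectable mi1 mi (drop i P'))
  where
    go : Maybe ℕ → Tableau × Bool
    go (just x) = (updateRow i (replaceVal mi x) P' , true)             -- (IR)
    go nothing  = (P' , false)                                          -- (NR)

-- State of Ψ(P,(r,c),α) after processing row r ∸ k (or, for α = 1 and k = 0,
-- after the deletion of cell (r,c)): current P' and α_{r ∸ k}.
-- α = 1 is `true`, α = 0 is `false`.
stateGo : Tableau → ℕ → ℕ → Bool → ℕ → Tableau × Bool
stateGo P r c true  zero = (updateRow r (take (c ∸ 1)) P , true)
stateGo P r c false zero = processRow (row P r) r (path P r c r) 0 false P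
stateGo P r c α (suc k) with stateGo P r c α k
... | (P' , a) = processRow (row P (r ∸ suc k)) (r ∸ suc k)
                   (path P r c (r ∸ suc k)) (path P r c (suc (r ∸ suc k))) a P'

alpha : Tableau → ℕ → ℕ → Bool → ℕ → Bool
alpha P r c α i = proj₂ (stateGo P r c α (r ∸ i))

output : Tableau → ℕ → ℕ → Bool → Tableau
output P r c α = proj₁ (stateGo P r c α (r ∸ 1))

fromRow : ℕ → Tableau → Tableau
fromRow i P = drop (i ∸ 1) P

{-# OPTIONS --safe #-}
-- Rows are processed from r upwards, and processing row i only rewrites row i, so
-- P'_{≥i} is final once row i is done; it suffices to check the claim right then.
-- In case (D), m_i - 1 lies in row i, and since m_i is the least entry of row i above
-- m_{i+1} this forces m_i - 1 = m_{i+1}; the row is untouched, so m_i is ejectable from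
-- P'_{≥i} exactly when m_{i+1} is ejectable from P'_{>i}, and α_i = α_{i+1}.
-- In cases (DR) and (IR), m_i is replaced by a smaller value, so it leaves row i and
-- α_i = 1; in case (NR) row i keeps m_i but not m_i - 1, and α_i = 0. For α = 1 the
-- deleted cell held m_r, the least entry of row r, so m_r is gone and α_r = 1.
module Submission where

open import Defs
open import Data.Nat using (ℕ; zero; suc; _+_; _∸_; _≤_; _<_; _≡ᵇ_; _<ᵇ_; z≤n; s≤s; z<s)
open import Data.Nat.Properties
open import Data.Bool using (Bool; true; false; T; _∧_; not)
open import Data.Bool.Properties using (T-≡; ∨-zeroʳ)
open import Data.List using (List; []; _∷_; length; take; drop)
open import Data.List.Relation.Unary.All using (All; []; _∷_)
open import Data.List.Relation.Unary.All.Properties using (all-upTo)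
open import Data.List.Relation.Unary.Linked using (Linked; []; [-]; _∷_)
open import Data.Maybe using (just; nothing; fromMaybe)
open import Data.Product using (∃; _×_; _,_; proj₁; proj₂)
open import Data.Sum using (_⊎_; inj₁; inj₂)
open import Function.Base using (id; _∘_)
open import Function.Bundles using (_⇔_; mk⇔; Equivalence)
open import Relation.Binary.PropositionalEquality
open ≡-Reasoning
open import Relation.Nullary using (contradiction)

≡ᵇ-true⇒≡ : ∀ {m n} → (m ≡ᵇ n) ≡ true → m ≡ n
≡ᵇ-true⇒≡ {m} {n} eq = ≡ᵇ⇒≡ m n (Equivalence.from T-≡ eq)

≡ᵇ-refl : ∀ n → (n ≡ᵇ n) ≡ true
≡ᵇ-refl n = Equivalence.to T-≡ (≡⇒≡ᵇ n n refl)

≢⇒≡ᵇ-false : ∀ {m n} → m ≢ n → (m ≡ᵇ n) ≡ false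
≢⇒≡ᵇ-false {m} {n} m≢n with m ≡ᵇ n in eq
... | true  = contradiction (≡ᵇ-true⇒≡ eq) m≢n
... | false = refl

≡ᵇ-false⇒≢ : ∀ {m n} → (m ≡ᵇ n) ≡ false → m ≢ n
≡ᵇ-false⇒≢ {m} eq refl = contradiction (trans (sym (≡ᵇ-refl m)) eq) λ ()

<ᵇ-true⇒< : ∀ {m n} → (m <ᵇ n) ≡ true → m < n
<ᵇ-true⇒< {m} {n} eq = <ᵇ⇒< m n (Equivalence.from T-≡ eq)

<ᵇ-false⇒≥ : ∀ {m n} → (m <ᵇ n) ≡ false → n ≤ m
<ᵇ-false⇒≥ eq = ≮⇒≥ (λ m<n → subst T eq (<⇒<ᵇ m<n))

m∸n≡suc[m∸suc[n]] : ∀ {m n} → n < m → m ∸ n ≡ suc (m ∸ suc n)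
m∸n≡suc[m∸suc[n]] n<m = +-∸-assoc 1 n<m

m∸suc[m∸suc[n]]≡n : ∀ {m n} → n < m → m ∸ suc (m ∸ suc n) ≡ n
m∸suc[m∸suc[n]]≡n {m} n<m = trans (cong (m ∸_) (sym (m∸n≡suc[m∸suc[n]] n<m))) (m∸[m∸n]≡n (<⇒≤ n<m))

downwardInduction : ∀ {r} (Q : ℕ → Set) → Q r → (∀ {i} → 1 ≤ i → i < r → Q (suc i) → Q i) →
               ∀ {i} → 1 ≤ i → i ≤ r → Q i
downwardInduction {r} Q base step {i} 1≤i i≤r = go (r ∸ i) 1≤i (m+[n∸m]≡n i≤r)
  where
  go : ∀ d {i} → 1 ≤ i → i + d ≡ r → Q i
  go zero    {i} _   eq = subst Q (trans (sym eq) (+-identityʳ i)) base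
  go (suc d) {i} 1≤i eq =
    step 1≤i (subst (i <_) eq (m<m+n i z<s)) (go d (s≤s z≤n) (trans (sym (+-suc i d)) eq))

elem-here : ∀ x R → elem x (x ∷ R) ≡ true
elem-here x R rewrite ≡ᵇ-refl x = refl

elem-there : ∀ x y R → elem x R ≡ true → elem x (y ∷ R) ≡ true
elem-there x y R eq rewrite eq = ∨-zeroʳ (x ≡ᵇ y)

elem-cons : ∀ x y R → elem x (y ∷ R) ≡ true → x ≡ y ⊎ elem x R ≡ true
elem-cons x y R eq with x ≡ᵇ y in x≡ᵇy
... | true  = inj₁ (≡ᵇ-true⇒≡ x≡ᵇy)
... | false = inj₂ eq

All-elem : ∀ {Q : ℕ → Set} {R x} → All Q R → elem x R ≡ true → Q x
All-elem                 []       ()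
All-elem {R = y ∷ R} {x} (q ∷ qs) e with elem-cons x y R e
... | inj₁ refl = q
... | inj₂ e′   = All-elem qs e′

nth-elem : ∀ R j {x} → nth R j ≡ just x → elem x R ≡ true
nth-elem R       zero              ()
nth-elem []      (suc j)           ()
nth-elem (y ∷ R) (suc zero)        refl = elem-here y R
nth-elem (y ∷ R) (suc (suc j)) {x} eq   = elem-there x y R (nth-elem R (suc j) eq)

nth-exists : ∀ R j → 1 ≤ j → j ≤ length R → ∃ λ x → nth R j ≡ just x
nth-exists (y ∷ R) (suc zero)    _ _          = y , refl
nth-exists (y ∷ R) (suc (suc j)) _ (s≤s j<∣R∣) = nth-exists R (suc j) (s≤s z≤n) j<∣R∣

elem-replaceVal : ∀ {a b} R → b ≢ a → elem a (replaceVal a b R) ≡ false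
elem-replaceVal         []      b≢a = refl
elem-replaceVal {a} {b} (y ∷ R) b≢a with y ≡ᵇ a in y≡ᵇa
... | true  rewrite ≢⇒≡ᵇ-false {a} {b} (b≢a ∘ sym)              = elem-replaceVal R b≢a
... | false rewrite ≢⇒≡ᵇ-false {a} {y} (≡ᵇ-false⇒≢ y≡ᵇa ∘ sym) = elem-replaceVal R b≢a

Decreasing : List ℕ → Set
Decreasing = Linked (λ x y → y < x)

last-least : ∀ {R x z} → Decreasing R → nth R (length R) ≡ just x → elem z R ≡ true → x ≤ z
last-least {y ∷ []} {z = z} _ refl e with elem-cons z y [] e
... | inj₁ refl = ≤-refl
last-least {y ∷ y′ ∷ R} {z = z} (y′<y ∷ dec) eq e with elem-cons z y (y′ ∷ R) e
... | inj₁ refl = <⇒≤ (≤-<-trans (last-least dec eq (elem-here y′ R)) y′<y)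
... | inj₂ e′   = last-least dec eq e′

last-∉-init : ∀ {R x} → Decreasing R → nth R (length R) ≡ just x → elem x (take (length R ∸ 1) R) ≡ false
last-∉-init {y ∷ []}         _            _  = refl
last-∉-init {y ∷ y′ ∷ R} {x} (y′<y ∷ dec) eq
  rewrite ≢⇒≡ᵇ-false {x} {y} (<⇒≢ (≤-<-trans (last-least dec eq (elem-here y′ R)) y′<y)) =
  last-∉-init dec eq

record IsLeastAbove (lo : ℕ) (R : List ℕ) (x : ℕ) : Set where
  field
    member : elem x R ≡ true
    above  : lo < x
    least  : ∀ {z} → elem z R ≡ true → lo < z → x ≤ z
open IsLeastAbove

leastAbove-here : ∀ {lo w R} → lo < w → (∀ {z} → elem z R ≡ true → lo < z → w ≤ z) →
                  IsLeastAbove lo (w ∷ R) w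
leastAbove-here {lo} {w} {R} lo<w w≤ = record
  { member = elem-here w R ; above = lo<w ; least = least′ }
  where
  least′ : ∀ {z} → elem z (w ∷ R) ≡ true → lo < z → w ≤ z
  least′ {z} e lo<z with elem-cons z w R e
  ... | inj₁ refl = ≤-refl
  ... | inj₂ e′   = w≤ e′ lo<z

leastAbove-there : ∀ {lo w R x} → IsLeastAbove lo R x → (lo < w → x ≤ w) → IsLeastAbove lo (w ∷ R) x
leastAbove-there {lo} {w} {R} {x} l x≤w = record
  { member = elem-there x w R (member l) ; above = above l ; least = least′ }
  where
  least′ : ∀ {z} → elem z (w ∷ R) ≡ true → lo < z → x ≤ z
  least′ {z} e lo<z with elem-cons z w R e
  ... | inj₁ refl = x≤w lo<z
  ... | inj₂ e′   = least l e′ lo<z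

minGT-leastAbove⊎ : ∀ y R → IsLeastAbove y R (minGT y R) ⊎
                            (minGT y R ≡ 0 × (∀ {z} → elem z R ≡ true → z ≤ y))
minGT-leastAbove⊎ y []      = inj₂ (refl , λ ())
minGT-leastAbove⊎ y (w ∷ R) with minGT y R | minGT-leastAbove⊎ y R | y <ᵇ w in y<ᵇw
... | _     | inj₁ l          | false =
  inj₁ (leastAbove-there l (λ y<w → contradiction (<ᵇ-false⇒≥ y<ᵇw) (<⇒≱ y<w)))
... | _     | inj₂ (refl , ≤y) | false = inj₂ (refl , ≤y′)
  where
  ≤y′ : ∀ {z} → elem z (w ∷ R) ≡ true → z ≤ y
  ≤y′ {z} e with elem-cons z w R e
  ... | inj₁ refl = <ᵇ-false⇒≥ y<ᵇw
  ... | inj₂ e′   = ≤y e′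
... | _     | inj₂ (refl , ≤y) | true =
  inj₁ (leastAbove-here (<ᵇ-true⇒< y<ᵇw) (λ e y<z → contradiction (≤y e) (<⇒≱ y<z)))
... | zero  | inj₁ l          | true = contradiction (above l) λ ()
... | suc a | inj₁ l          | true with ≤-total w (suc a)
...   | inj₁ w≤a rewrite m≤n⇒m⊓n≡m w≤a =
  inj₁ (leastAbove-here (<ᵇ-true⇒< y<ᵇw) (λ e y<z → ≤-trans w≤a (least l e y<z)))
...   | inj₂ a≤w rewrite m≥n⇒m⊓n≡n a≤w = inj₁ (leastAbove-there l (λ _ → a≤w))

minGT-leastAbove : ∀ {y R z} → elem z R ≡ true → y < z → IsLeastAbove y R (minGT y R)
minGT-leastAbove {y} {R} e y<z with minGT-leastAbove⊎ y R
... | inj₁ l        = l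
... | inj₂ (_ , ≤y) = contradiction (≤y e) (<⇒≱ y<z)

leastAbove-pred : ∀ {lo R x} → IsLeastAbove lo R x → elem (x ∸ 1) R ≡ true → x ∸ 1 ≡ lo
leastAbove-pred {x = zero}  l _ = contradiction (above l) λ ()
leastAbove-pred {x = suc k} l e = ≤-antisym (≮⇒≥ (λ lo<k → <-irrefl refl (least l e lo<k))) (<⇒≤pred (above l))

ejectable-absent : ∀ x R T → elem x R ≡ false → ejectable x (R ∷ T) ≡ false
ejectable-absent _ _ _ x∉R rewrite x∉R = refl

ejectable-top : ∀ x R T → elem x R ≡ true → elem (x ∸ 1) R ≡ false → ejectable x (R ∷ T) ≡ true
ejectable-top _ _ _ x∈R x-1∉R rewrite x∈R | x-1∉R = refl

ejectable-pred : ∀ x R T → elem x R ≡ true → elem (x ∸ 1) R ≡ true →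
                 ejectable x (R ∷ T) ≡ ejectable (x ∸ 1) T
ejectable-pred _ _ _ x∈R x-1∈R rewrite x∈R | x-1∈R = refl

findᵇ-All : ∀ {Q : ℕ → Set} p {xs x} → All Q xs → findᵇ p xs ≡ just x → Q x
findᵇ-All p {y ∷ xs} (q ∷ qs) eq with p y | eq
... | true  | refl = q
... | false | eq′  = findᵇ-All p qs eq′

smallestEjectable-< : ∀ {lo hi T x} → smallestEjectable lo hi T ≡ just x → x < hi
smallestEjectable-< {hi = hi} = findᵇ-All _ (all-upTo hi)

updateRow-id : ∀ i S → updateRow i id S ≡ S
updateRow-id zero          S       = refl
updateRow-id (suc i)       []      = refl
updateRow-id (suc zero)    (R ∷ S) = refl
updateRow-id (suc (suc i)) (R ∷ S) = cong (R ∷_) (updateRow-id (suc i) S)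

row-updateRow-≢ : ∀ i {j} f S → j ≢ i → row (updateRow i f S) j ≡ row S j
row-updateRow-≢ zero                        f S       _   = refl
row-updateRow-≢ (suc i)                     f []      _   = refl
row-updateRow-≢ (suc zero)    {zero}        f (R ∷ S) _   = refl
row-updateRow-≢ (suc zero)    {suc zero}    f (R ∷ S) j≢i = contradiction refl j≢i
row-updateRow-≢ (suc zero)    {suc (suc j)} f (R ∷ S) _   = refl
row-updateRow-≢ (suc (suc i)) {zero}        f (R ∷ S) _   = refl
row-updateRow-≢ (suc (suc i)) {suc zero}    f (R ∷ S) _   = refl
row-updateRow-≢ (suc (suc i)) {suc (suc j)} f (R ∷ S) j≢i = row-updateRow-≢ (suc i) f S (j≢i ∘ cong suc)

drop-updateRow-≥ : ∀ {i n} f S → i ≤ n → drop n (updateRow i f S) ≡ drop n S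
drop-updateRow-≥ {zero}        f S       _         = refl
drop-updateRow-≥ {suc i}       f []      _         = refl
drop-updateRow-≥ {suc zero}    f (R ∷ S) (s≤s _)   = refl
drop-updateRow-≥ {suc (suc i)} f (R ∷ S) (s≤s i≤n) = drop-updateRow-≥ {suc i} f S i≤n

drop-updateRow : ∀ {i R T} f S → 1 ≤ i → drop (i ∸ 1) S ≡ R ∷ T → drop (i ∸ 1) (updateRow i f S) ≡ f R ∷ T
drop-updateRow {suc zero}    f (R ∷ S) _ refl = refl
drop-updateRow {suc (suc i)} f (R ∷ S) _ eq   = drop-updateRow {suc i} f S (s≤s z≤n) eq

drop-row : ∀ S i → 0 < length (row S i) → drop (i ∸ 1) S ≡ row S i ∷ drop i S
drop-row (R ∷ S) (suc zero)    _       = refl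
drop-row (R ∷ S) (suc (suc i)) ∣row∣>0 = drop-row S (suc i) ∣row∣>0

row-All : ∀ {Q : List ℕ → Set} {S} → All Q S → Q [] → ∀ i → Q (row S i)
row-All qs       q[] zero          = q[]
row-All []       q[] (suc i)       = q[]
row-All (q ∷ qs) q[] (suc zero)    = q
row-All (q ∷ qs) q[] (suc (suc i)) = row-All qs q[] (suc i)

row-length-suc : ∀ {S} → Linked (λ R R′ → length R′ ≤ length R) S → ∀ i →
                 length (row S (suc (suc i))) ≤ length (row S (suc i))
row-length-suc []       i       = z≤n
row-length-suc [-]      i       = z≤n
row-length-suc (l ∷ ls) zero    = l
row-length-suc (l ∷ ls) (suc i) = row-length-suc ls i

EditsOnlyRow : ℕ → Tableau → Tableau → Set
EditsOnlyRow i S S′ = ∃ λ f → S′ ≡ updateRow i f S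

row-edit-≢ : ∀ {i j S S′} → EditsOnlyRow i S S′ → j ≢ i → row S′ j ≡ row S j
row-edit-≢ {i} {S = S} (f , refl) = row-updateRow-≢ i f S

drop-edit-≥ : ∀ {i n S S′} → EditsOnlyRow i S S′ → i ≤ n → drop n S′ ≡ drop n S
drop-edit-≥ {S = S} (f , refl) = drop-updateRow-≥ f S

data RowOutcome (R : List ℕ) (i mi : ℕ) (a : Bool) (S : Tableau) : Tableau × Bool → Set where
  deferred : elem (mi ∸ 1) R ≡ true → RowOutcome R i mi a S (S , a)
  replaced : ∀ x → x < mi → RowOutcome R i mi a S (updateRow i (replaceVal mi x) S , true)
  kept     : elem (mi ∸ 1) R ≡ false → RowOutcome R i mi a S (S , false)

processRow-outcome : ∀ R i {mi mi1} a S → mi1 < mi → RowOutcome R i mi a S (processRow R i mi mi1 a S)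
processRow-outcome R i {mi} {mi1} a S mi1<mi with elem (mi ∸ 1) R in e
... | true = deferred e
... | false with a ∧ not (elem mi1 R)
...   | true = replaced mi1 mi1<mi
...   | false with smallestEjectable mi1 mi (drop i S) in x-found
...     | just x  = replaced x (smallestEjectable-< {T = drop i S} x-found)
...     | nothing = kept e

outcome-edits : ∀ {R i mi a S res} → RowOutcome R i mi a S res → EditsOnlyRow i S (proj₁ res)
outcome-edits {i = i} {S = S} (deferred _)   = id , sym (updateRow-id i S)
outcome-edits                 (replaced x _) = replaceVal _ x , refl
outcome-edits {i = i} {S = S} (kept _)       = id , sym (updateRow-id i S)

processRow-edits : ∀ R i {mi mi1} a S → mi1 < mi → EditsOnlyRow i S (proj₁ (processRow R i mi mi1 a S))
processRow-edits R i a S mi1<mi = outcome-edits (processRow-outcome R i a S mi1<mi)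

StatusIffEjectable : ℕ → ℕ → Tableau × Bool → Set
StatusIffEjectable i mi (S , a) = (a ≡ false) ⇔ (ejectable mi (drop (i ∸ 1) S) ≡ true)

-- At row r with α = 0 the algorithm uses m_{r+1} = 0, about which nothing is claimed;
-- hence the guard 0 < mi1 on the hypothesis for the row below.
processRow-statusIffEjectable : ∀ {R T i mi mi1 a S} → 1 ≤ i → drop (i ∸ 1) S ≡ R ∷ T → All (0 <_) R →
  IsLeastAbove mi1 R mi → (0 < mi1 → (a ≡ false) ⇔ (ejectable mi1 T ≡ true)) →
  StatusIffEjectable i mi (processRow R i mi mi1 a S)
processRow-statusIffEjectable {R} {T} {i} {mi} {mi1} {a} {S} 1≤i split pos l ih
  with processRow R i mi mi1 a S | processRow-outcome R i a S (above l)
... | _ | deferred mi-1∈R =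
  subst (λ b → (a ≡ false) ⇔ (b ≡ true)) (sym ejects-mi1) (ih (subst (0 <_) mi-1≡mi1 (All-elem pos mi-1∈R)))
  where
  mi-1≡mi1 : mi ∸ 1 ≡ mi1
  mi-1≡mi1 = leastAbove-pred l mi-1∈R
  ejects-mi1 : ejectable mi (drop (i ∸ 1) S) ≡ ejectable mi1 T
  ejects-mi1 = begin
    ejectable mi (drop (i ∸ 1) S) ≡⟨ cong (ejectable mi) split ⟩
    ejectable mi (R ∷ T)          ≡⟨ ejectable-pred mi R T (member l) mi-1∈R ⟩
    ejectable (mi ∸ 1) T          ≡⟨ cong (λ v → ejectable v T) mi-1≡mi1 ⟩
    ejectable mi1 T               ∎
... | _ | replaced x x<mi
  rewrite drop-updateRow (replaceVal mi x) S 1≤i split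
        | ejectable-absent mi (replaceVal mi x R) T (elem-replaceVal R (<⇒≢ x<mi))
  = mk⇔ (λ ()) (λ ())
... | _ | kept mi-1∉R =
  mk⇔ (λ _ → trans (cong (ejectable mi) split) (ejectable-top mi R T (member l) mi-1∉R)) (λ _ → refl)

module ReverseInsertion {P : Tableau} {r c : ℕ} (dec : IsDecreasingTableau P) (rem : Removable P r c) where
  open IsDecreasingTableau dec
  open Removable rem

  after : Bool → ℕ → Tableau × Bool
  after α i = stateGo P r c α (r ∸ i)

  after-r : ∀ α → after α r ≡ stateGo P r c α 0
  after-r α = cong (stateGo P r c α) (n∸n≡0 r)

  stateGo-suc : ∀ α k → stateGo P r c α (suc k) ≡
    processRow (row P (r ∸ suc k)) (r ∸ suc k) (path P r c (r ∸ suc k)) (path P r c (suc (r ∸ suc k)))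
               (proj₂ (stateGo P r c α k)) (proj₁ (stateGo P r c α k))
  stateGo-suc true  k = refl
  stateGo-suc false k = refl

  after-step : ∀ α {i} → i < r → after α i ≡
    processRow (row P i) i (path P r c i) (path P r c (suc i)) (proj₂ (after α (suc i))) (proj₁ (after α (suc i)))
  after-step α {i} i<r = begin
    stateGo P r c α (r ∸ i)             ≡⟨ cong (stateGo P r c α) (m∸n≡suc[m∸suc[n]] i<r) ⟩
    stateGo P r c α (suc (r ∸ suc i))   ≡⟨ stateGo-suc α (r ∸ suc i) ⟩
    processRowAt (r ∸ suc (r ∸ suc i))  ≡⟨ cong processRowAt (m∸suc[m∸suc[n]]≡n i<r) ⟩
    processRowAt i                      ∎
    where
    processRowAt : ℕ → Tableau × Bool
    processRowAt j = processRow (row P j) j (path P r c j) (path P r c (suc j))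
                       (proj₂ (after α (suc i))) (proj₁ (after α (suc i)))

  path-r : path P r c r ≡ fromMaybe 0 (entry P r c)
  path-r = cong (pathGo P r c) (n∸n≡0 r)

  path-suc : ∀ {i} → i < r → path P r c i ≡ minGT (path P r c (suc i)) (row P i)
  path-suc {i} i<r = begin
    pathGo P r c (r ∸ i)                  ≡⟨ cong (pathGo P r c) (m∸n≡suc[m∸suc[n]] i<r) ⟩
    minAbove (r ∸ suc (r ∸ suc i))        ≡⟨ cong minAbove (m∸suc[m∸suc[n]]≡n i<r) ⟩
    minAbove i                            ∎
    where
    minAbove : ℕ → ℕ
    minAbove j = minGT (path P r c (suc i)) (row P j)

  c≤length-row : ∀ {i} → 1 ≤ i → i ≤ r → c ≤ length (row P i)
  c≤length-row = downwardInduction (λ i → c ≤ length (row P i)) (≤-reflexive (sym lastInRow)) step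
    where
    step : ∀ {i} → 1 ≤ i → i < r → c ≤ length (row P (suc i)) → c ≤ length (row P i)
    step {suc i} _ _ c≤ = ≤-trans c≤ (row-length-suc shape i)

  row-nonempty : ∀ {i} → 1 ≤ i → i ≤ r → 0 < length (row P i)
  row-nonempty 1≤i i≤r = ≤-trans c≥1 (c≤length-row 1≤i i≤r)

  row-positive : ∀ i → All (0 <_) (row P i)
  row-positive = row-All positive []

  row-decreasing : ∀ i → Decreasing (row P i)
  row-decreasing = row-All rowsDecr []

  column-entry : ∀ {i} → 1 ≤ i → i ≤ r → ∃ λ e → entry P i c ≡ just e
  column-entry 1≤i i≤r = nth-exists _ c c≥1 (c≤length-row 1≤i i≤r)

  BoundedByColumn : ℕ → Set
  BoundedByColumn i = ∀ {e} → entry P i c ≡ just e → path P r c i ≤ e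

  path-suc<column : ∀ {i e} → i < r → BoundedByColumn (suc i) → entry P i c ≡ just e → path P r c (suc i) < e
  path-suc<column {i} i<r bounded eq with column-entry (s≤s z≤n) i<r
  ... | e′ , eq′ = ≤-<-trans (bounded eq′) (colsDecr i c _ e′ eq eq′)

  leastAbove-column : ∀ {i e} → i < r → entry P i c ≡ just e → path P r c (suc i) < e →
                      IsLeastAbove (path P r c (suc i)) (row P i) (path P r c i)
  leastAbove-column {i} i<r eq lt =
    subst (IsLeastAbove _ _) (sym (path-suc i<r)) (minGT-leastAbove (nth-elem (row P i) c eq) lt)

  path-bounded : ∀ {i} → 1 ≤ i → i ≤ r → BoundedByColumn i
  path-bounded = downwardInduction BoundedByColumn base step
    where
    base : BoundedByColumn r
    base eq = ≤-reflexive (trans path-r (cong (fromMaybe 0) eq))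
    step : ∀ {i} → 1 ≤ i → i < r → BoundedByColumn (suc i) → BoundedByColumn i
    step {i} _ i<r bounded {e} eq =
      least (leastAbove-column i<r eq lt) (nth-elem (row P i) c eq) lt
      where
      lt : path P r c (suc i) < e
      lt = path-suc<column i<r bounded eq

  path-leastAbove : ∀ {i} → 1 ≤ i → i < r → IsLeastAbove (path P r c (suc i)) (row P i) (path P r c i)
  path-leastAbove 1≤i i<r with column-entry 1≤i (<⇒≤ i<r)
  ... | e , eq = leastAbove-column i<r eq (path-suc<column i<r (path-bounded (s≤s z≤n) i<r) eq)

  last-entry : nth (row P r) (length (row P r)) ≡ just (path P r c r)
  last-entry with column-entry r≥1 ≤-refl
  ... | e , eq = begin
    nth (row P r) (length (row P r)) ≡⟨ cong (nth (row P r)) lastInRow ⟩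
    entry P r c                      ≡⟨ eq ⟩
    just e                           ≡⟨ cong just (sym (trans path-r (cong (fromMaybe 0) eq))) ⟩
    just (path P r c r)              ∎

  last-leastAbove : IsLeastAbove 0 (row P r) (path P r c r)
  last-leastAbove = record
    { member = path∈row
    ; above  = All-elem (row-positive r) path∈row
    ; least  = λ e _ → last-least (row-decreasing r) last-entry e
    }
    where
    path∈row : elem (path P r c r) (row P r) ≡ true
    path∈row = nth-elem (row P r) (length (row P r)) last-entry

  after-r-edits : ∀ α → EditsOnlyRow r P (proj₁ (after α r))
  after-r-edits α = subst (EditsOnlyRow r P ∘ proj₁) (sym (after-r α)) (first-step-edits α)
    where
    first-step-edits : ∀ α → EditsOnlyRow r P (proj₁ (stateGo P r c α 0))
    first-step-edits true  = take (c ∸ 1) , refl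
    first-step-edits false = processRow-edits (row P r) r false P (above last-leastAbove)

  after-edits : ∀ α {i} → 1 ≤ i → i < r → EditsOnlyRow i (proj₁ (after α (suc i))) (proj₁ (after α i))
  after-edits α {i} 1≤i i<r = subst (EditsOnlyRow i S ∘ proj₁) (sym (after-step α i<r))
    (processRow-edits (row P i) i (proj₂ (after α (suc i))) S (above (path-leastAbove 1≤i i<r)))
    where
    S : Tableau
    S = proj₁ (after α (suc i))

  after-rows-above : ∀ α {i} → 1 ≤ i → i ≤ r → ∀ {j} → j < i → row (proj₁ (after α i)) j ≡ row P j
  after-rows-above α = downwardInduction RowsAbove (λ j<r → row-edit-≢ (after-r-edits α) (<⇒≢ j<r)) step
    where
    RowsAbove : ℕ → Set
    RowsAbove i = ∀ {j} → j < i → row (proj₁ (after α i)) j ≡ row P j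
    step : ∀ {i} → 1 ≤ i → i < r → RowsAbove (suc i) → RowsAbove i
    step 1≤i i<r rows j<i = trans (row-edit-≢ (after-edits α 1≤i i<r) (<⇒≢ j<i)) (rows (m<n⇒m<1+n j<i))

  after-split : ∀ α {i} → 1 ≤ i → i < r →
    drop (i ∸ 1) (proj₁ (after α (suc i))) ≡ row P i ∷ drop i (proj₁ (after α (suc i)))
  after-split α {i} 1≤i i<r = trans (drop-row S i nonempty) (cong (_∷ drop i S) row-i)
    where
    S : Tableau
    S = proj₁ (after α (suc i))
    row-i : row S i ≡ row P i
    row-i = after-rows-above α (s≤s z≤n) i<r (n<1+n i)
    nonempty : 0 < length (row S i)
    nonempty = subst (λ R → 0 < length R) (sym row-i) (row-nonempty 1≤i (<⇒≤ i<r))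

  P-split : drop (r ∸ 1) P ≡ row P r ∷ drop r P
  P-split = drop-row P r (row-nonempty r≥1 ≤-refl)

  after-stable : ∀ α n {m} → suc n ≤ r → n ≤ m → drop m (proj₁ (after α (suc n))) ≡ drop m (output P r c α)
  after-stable α zero    _    _   = refl
  after-stable α (suc n) n<r n<m =
    trans (sym (drop-edit-≥ (after-edits α (s≤s z≤n) n<r) n<m)) (after-stable α n (<⇒≤ n<r) (<⇒≤ n<m))

  after-statusIffEjectable : ∀ α {i} → 1 ≤ i → i ≤ r → StatusIffEjectable i (path P r c i) (after α i)
  after-statusIffEjectable α =
    downwardInduction (λ i → StatusIffEjectable i (path P r c i) (after α i)) (base α) step
    where
    base : ∀ α → StatusIffEjectable r (path P r c r) (after α r)
    base true = subst (StatusIffEjectable r (path P r c r)) (sym (after-r true)) last-removed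
      where
      path∉shortened : elem (path P r c r) (take (c ∸ 1) (row P r)) ≡ false
      path∉shortened = subst (λ n → elem (path P r c r) (take (n ∸ 1) (row P r)) ≡ false) lastInRow
                         (last-∉-init (row-decreasing r) last-entry)
      last-removed : StatusIffEjectable r (path P r c r) (updateRow r (take (c ∸ 1)) P , true)
      last-removed rewrite drop-updateRow (take (c ∸ 1)) P r≥1 P-split
                         | ejectable-absent (path P r c r) (take (c ∸ 1) (row P r)) (drop r P) path∉shortened
        = mk⇔ (λ ()) (λ ())
    base false = subst (StatusIffEjectable r (path P r c r)) (sym (after-r false))
                   (processRow-statusIffEjectable r≥1 P-split (row-positive r) last-leastAbove (λ ()))
    step : ∀ {i} → 1 ≤ i → i < r → StatusIffEjectable (suc i) (path P r c (suc i)) (after α (suc i)) →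
           StatusIffEjectable i (path P r c i) (after α i)
    step {i} 1≤i i<r inv = subst (StatusIffEjectable i (path P r c i)) (sym (after-step α i<r))
      (processRow-statusIffEjectable {S = proj₁ (after α (suc i))} 1≤i (after-split α 1≤i i<r) (row-positive i)
         (path-leastAbove 1≤i i<r) (λ _ → inv))

lemma3p1 : (P : Tableau) (r c : ℕ) (α : Bool) →
    IsDecreasingTableau P → Removable P r c →
    (i : ℕ) → 1 ≤ i → i ≤ r →
    (alpha P r c α i ≡ false) ⇔ (ejectable (path P r c i) (fromRow i (output P r c α)) ≡ true)
lemma3p1 P r c α dec rem (suc n) 1≤i i≤r =
  subst (λ T → (alpha P r c α (suc n) ≡ false) ⇔ (ejectable (path P r c (suc n)) T ≡ true))
        (after-stable α n i≤r ≤-refl) (after-statusIffEjectable α 1≤i i≤r)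
  where open ReverseInsertion dec rem
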